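{- Let $n\ge1$ and let $f:A\to B$ be a homomorphism of $n$-torsion abelian groups. Suppose there exist a positive divisor $m$ of $n$ and an element $P\in A$ such that: (i) $P$ is not divisible by $m$ in $A$, but $f(P)$ is divisible by $m$ in $B$; (ii) every element of $\ker(f)$ is divisible by $m$ in $A$. Then $f(A)$ is not a direct summand of $B$.
   Context: An abelian group $M$ is $n$-torsion if $nM=0$. An element $a\in A$ is divisible by $m$ in $A$ if $a=ma'$ for some $a'\in A$. -}

module Defs where

open import Level using (Level; _⊔_; suc)
open import Data.Nat using (ℕ)
open import Data.Product using (Σ; _×_; ∃)
open import Relation.Unary using (Pred)
open import Algebra.Bundles using (AbelianGroup)
open import Algebra.Morphism.Structures using (module GroupMorphisms)
import Algebra.Definitions.RawMonoid as RM

module _ {c ℓ : Level} (G : AbelianGroup c ℓ) where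
  open AbelianGroup G
  open RM rawMonoid using () renaming (_×_ to _·_)

  IsTorsion : ℕ → Set (c ⊔ ℓ)
  IsTorsion n = ∀ x → (n · x) ≈ ε

  DivisibleBy : ℕ → Carrier → Set (c ⊔ ℓ)
  DivisibleBy m a = Σ Carrier (λ a' → a ≈ (m · a'))

  record IsSubgroup {p : Level} (S : Pred Carrier p) : Set (c ⊔ ℓ ⊔ p) where
    field
      resp  : ∀ {x y} → x ≈ y → S x → S y
      ε-mem : S ε
      ∙-mem : ∀ {x y} → S x → S y → S (x ∙ y)
      ⁻¹-mem : ∀ {x} → S x → S (x ⁻¹)

  IsDirectSummand : {q : Level} (p : Level) → Pred Carrier q → Set (c ⊔ ℓ ⊔ q ⊔ suc p)
  IsDirectSummand p S =
    Σ (Pred Carrier p) λ C →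
      IsSubgroup C
      × (∀ b → Σ Carrier λ s → Σ Carrier λ t → S s × C t × (b ≈ (s ∙ t)))
      × (∀ x → S x → C x → x ≈ ε)

module _ {a ℓa b ℓb : Level} (A : AbelianGroup a ℓa) (B : AbelianGroup b ℓb) where
  open GroupMorphisms (AbelianGroup.rawGroup A) (AbelianGroup.rawGroup B) public
    using (IsGroupHomomorphism)

  Image : (AbelianGroup.Carrier A → AbelianGroup.Carrier B) → Pred (AbelianGroup.Carrier B) (a ⊔ ℓb)
  Image f y = Σ (AbelianGroup.Carrier A) λ x → AbelianGroup._≈_ B y (f x)

  Kernel : (AbelianGroup.Carrier A → AbelianGroup.Carrier B) → Pred (AbelianGroup.Carrier A) ℓb
  Kernel f x = AbelianGroup._≈_ B (f x) (AbelianGroup.ε B)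

module Submission where

-- Suppose B = f(A) ⊕ C and write f(P) = m·b.  Decomposing
-- b = s + t with s ∈ f(A), t ∈ C gives f(P) - m·s = m·t, an element of
-- f(A) ∩ C, hence zero; so f(P) = m·s is divisible by m already inside the
-- image.  Writing s = f(x), the element P - m·x lies in ker f, so by (ii) it
-- equals m·y, and then P = m·(y + x), contradicting (i).

open import Defs
open import Level using (Level)
open import Data.Nat using (ℕ; _≥_; _>_; zero; suc)
open import Data.Nat.Divisibility using (_∣_)
open import Data.Product using (Σ; _×_; _,_; proj₁; proj₂)
open import Relation.Nullary using (¬_)
open import Relation.Unary using (Pred)
open import Algebra.Bundles using (AbelianGroup)
import Algebra.Definitions.RawMonoid as RawMonoidDefinitions
import Algebra.Properties.CommutativeMonoid.Mult as CommutativeMonoidMult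
import Algebra.Properties.AbelianGroup as AbelianGroupProperties
import Relation.Binary.Reasoning.Setoid as SetoidReasoning

module DirectSummands {c ℓ : Level} (G : AbelianGroup c ℓ) where
  open AbelianGroup G
  open RawMonoidDefinitions rawMonoid using () renaming (_×_ to _·_)
  open CommutativeMonoidMult commutativeMonoid using (×-congʳ; ×-distrib-+)
  open AbelianGroupProperties G using (xyx⁻¹≈y; x∙y⁻¹≈ε⇒x≈y)

  ×-mem : ∀ {p} {S : Pred Carrier p} → IsSubgroup G S →
          ∀ k {x} → S x → S (k · x)
  ×-mem subS zero    _  = IsSubgroup.ε-mem subS
  ×-mem subS (suc k) Sx = IsSubgroup.∙-mem subS Sx (×-mem subS k Sx)

  -- Divisibility descends to a direct summand: if y ∈ S is divisible by m
  -- in G and G = S ⊕ C, then y = m·s for some s ∈ S.  Indeed, for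
  -- b = s + t the difference y - m·s = m·t lies in S ∩ C.
  summand-divisible : ∀ {p q} {S : Pred Carrier q} → IsSubgroup G S →
                      IsDirectSummand G p S →
                      ∀ m {y} → S y → DivisibleBy G m y →
                      Σ Carrier λ s → S s × (y ≈ m · s)
  summand-divisible {S = S} subS (C , subC , decompose , disjoint) m {y} Sy (b , y≈mb)
    with decompose b
  ... | s , t , Ss , Ct , b≈s∙t = s , Ss , x∙y⁻¹≈ε⇒x≈y y (m · s) difference≈ε
    where
    open SetoidReasoning setoid

    difference≈mt : y ∙ (m · s) ⁻¹ ≈ m · t
    difference≈mt = begin
      y ∙ (m · s) ⁻¹               ≈⟨ ∙-congʳ y≈mb ⟩
      m · b ∙ (m · s) ⁻¹           ≈⟨ ∙-congʳ (×-congʳ m b≈s∙t) ⟩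
      m · (s ∙ t) ∙ (m · s) ⁻¹     ≈⟨ ∙-congʳ (×-distrib-+ s t m) ⟩
      m · s ∙ m · t ∙ (m · s) ⁻¹   ≈⟨ xyx⁻¹≈y (m · s) (m · t) ⟩
      m · t                        ∎

    difference∈S : S (y ∙ (m · s) ⁻¹)
    difference∈S = IsSubgroup.∙-mem subS Sy
                     (IsSubgroup.⁻¹-mem subS (×-mem subS m Ss))

    difference∈C : C (y ∙ (m · s) ⁻¹)
    difference∈C = IsSubgroup.resp subC (sym difference≈mt) (×-mem subC m Ct)

    difference≈ε : y ∙ (m · s) ⁻¹ ≈ ε
    difference≈ε = disjoint _ difference∈S difference∈C

module Homomorphisms {a ℓa b ℓb : Level}
  (A : AbelianGroup a ℓa) (B : AbelianGroup b ℓb)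
  (f : AbelianGroup.Carrier A → AbelianGroup.Carrier B)
  (hom : IsGroupHomomorphism A B f) where

  module A = AbelianGroup A
  module B = AbelianGroup B
  open RawMonoidDefinitions A.rawMonoid using () renaming (_×_ to _·A_)
  open RawMonoidDefinitions B.rawMonoid public using () renaming (_×_ to _·B_)
  open CommutativeMonoidMult A.commutativeMonoid using (×-distrib-+)
  open AbelianGroupProperties A using (//-rightDividesˡ)
  open IsGroupHomomorphism A B hom using (homo; ε-homo; ⁻¹-homo)

  ×-homo : ∀ k x → f (k ·A x) B.≈ k ·B f x
  ×-homo zero    x = ε-homo
  ×-homo (suc k) x = B.trans (homo x (k ·A x)) (B.∙-congˡ (×-homo k x))

  image-isSubgroup : IsSubgroup B (Image A B f)
  image-isSubgroup = record
    { resp   = λ { y≈y′ (x , y≈fx) → x , B.trans (B.sym y≈y′) y≈fx }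
    ; ε-mem  = A.ε , B.sym ε-homo
    ; ∙-mem  = λ { (x , y≈fx) (x′ , y′≈fx′) →
                 x A.∙ x′ , B.trans (B.∙-cong y≈fx y′≈fx′) (B.sym (homo x x′)) }
    ; ⁻¹-mem = λ { (x , y≈fx) → x A.⁻¹ , B.trans (B.⁻¹-cong y≈fx) (B.sym (⁻¹-homo x)) }
    }

  image-summand-divisible : ∀ {p} → IsDirectSummand B p (Image A B f) →
                            ∀ m P → DivisibleBy B m (f P) →
                            Σ A.Carrier λ x → f P B.≈ m ·B f x
  image-summand-divisible summand m P fP-divisible
    with DirectSummands.summand-divisible B image-isSubgroup summand m
           (P , B.refl) fP-divisible
  ... | s , (x , s≈fx) , fP≈ms = x , B.trans fP≈ms (×-congʳ m s≈fx)
    where open CommutativeMonoidMult B.commutativeMonoid using (×-congʳ)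

  -- If every element of the kernel is divisible by m, then divisibility by
  -- m of f(P) inside the image lifts to P: from f(P) = m·f(x) we get
  -- P - m·x ∈ ker f, so P - m·x = m·y and P = m·(y + x).
  divisible-from-kernel : ∀ m → (∀ x → Kernel A B f x → DivisibleBy A m x) →
                          ∀ P x → f P B.≈ m ·B f x → DivisibleBy A m P
  divisible-from-kernel m kernel-divisible P x fP≈mfx = y A.∙ x , P≈m[y+x]
    where
    w : A.Carrier
    w = P A.∙ (m ·A x) A.⁻¹

    w∈kernel : f w B.≈ B.ε
    w∈kernel = begin
      f w                               ≈⟨ homo P ((m ·A x) A.⁻¹) ⟩
      f P B.∙ f ((m ·A x) A.⁻¹)         ≈⟨ B.∙-cong fP≈mfx (⁻¹-homo (m ·A x)) ⟩
      m ·B f x B.∙ f (m ·A x) B.⁻¹      ≈⟨ B.∙-congˡ (B.⁻¹-cong (×-homo m x)) ⟩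
      m ·B f x B.∙ (m ·B f x) B.⁻¹      ≈⟨ B.inverseʳ (m ·B f x) ⟩
      B.ε                               ∎
      where open SetoidReasoning B.setoid

    y : A.Carrier
    y = proj₁ (kernel-divisible w w∈kernel)

    w≈my : w A.≈ m ·A y
    w≈my = proj₂ (kernel-divisible w w∈kernel)

    P≈m[y+x] : P A.≈ m ·A (y A.∙ x)
    P≈m[y+x] = begin
      P                    ≈⟨ A.sym (//-rightDividesˡ (m ·A x) P) ⟩
      w A.∙ m ·A x         ≈⟨ A.∙-congʳ w≈my ⟩
      m ·A y A.∙ m ·A x    ≈⟨ A.sym (×-distrib-+ y x m) ⟩
      m ·A (y A.∙ x)       ∎
      where open SetoidReasoning A.setoid

lemma3p1 : {a ℓa b ℓb : Level} (n : ℕ) → n ≥ 1 →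
    (A : AbelianGroup a ℓa) (B : AbelianGroup b ℓb) →
    IsTorsion A n → IsTorsion B n →
    (f : AbelianGroup.Carrier A → AbelianGroup.Carrier B) → IsGroupHomomorphism A B f →
    (m : ℕ) → m > 0 → m ∣ n → (P : AbelianGroup.Carrier A) →
    ¬ DivisibleBy A m P → DivisibleBy B m (f P) →
    (∀ x → Kernel A B f x → DivisibleBy A m x) →
    ∀ (p : Level) → ¬ IsDirectSummand B p (Image A B f)
lemma3p1 _ _ A B _ _ f hom m _ _ P P-not-divisible fP-divisible kernel-divisible _ summand =
  P-not-divisible (divisible-from-kernel m kernel-divisible P x fP≈mfx)
  where
  open Homomorphisms A B f hom

  lift : Σ A.Carrier λ x → f P B.≈ m ·B f x
  lift = image-summand-divisible summand m P fP-divisible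

  x : A.Carrier
  x = proj₁ lift

  fP≈mfx : f P B.≈ m ·B f x
  fP≈mfx = proj₂ lift
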